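{- First-order logic extended with dependence atoms $=\!(\vec x,\vec y)$, inclusion atoms $\vec x\subseteq\vec y$ and conditional independence atoms $\vec y\perp_{\vec x}\vec z$ is weakly flat under (lax) multiteam semantics.
   Context: Setting: (lax) multiteam semantics. A multiteam $(X,m)$ is a team $X$ (finite set of assignments) with a multiplicity function $m\colon X\to\mathbb N$; structures are multistructures with a multiset domain. The atoms $=\!(\vec x,\vec y)$, $\vec x\subseteq\vec y$, $\vec y\perp_{\vec x}\vec z$ are satisfied by $(X,m)$ iff they are satisfied, in ordinary team semantics, by the team $\{s\in X\mid m(s)\ge 1\}$. A formula $\varphi$ is weakly flat if for all multistructures $\mathfrak A$ and all multiteams $(X,m)$, $\mathfrak{A}\models_{(X,m)}\varphi \Leftrightarrow \mathfrak{A}\models_{(X,n)}\varphi$, where $n(s)=0$ if $m(s)=0$ and $n(s)=1$ otherwise; a logic is weakly flat if all its formulas are. -}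

module Defs where

open import Data.Nat using (ℕ; zero; suc; _+_; _*_; _≤_)
open import Data.Fin using (Fin)
open import Data.Vec using (Vec; []; _∷_; lookup; map; _[_]≔_)
open import Data.Product using (Σ; ∃; _×_; _,_)
open import Relation.Binary.PropositionalEquality using (_≡_)
open import Relation.Nullary using (¬_)
open import Function.Bundles using (_⇔_)

-- Vocabularies (relation and function symbols with arities;
-- constants are 0-ary function symbols)

record Signature : Set₁ where
  field
    Rel    : Set
    Fun    : Set
    rarity : Rel → ℕ
    farity : Fun → ℕ
open Signature public

data Term (σ : Signature) (nv : ℕ) : Set where
  var : Fin nv → Term σ nv
  app : (f : Fun σ) → Vec (Term σ nv) (farity σ f) → Term σ nv

data Atom (σ : Signature) (nv : ℕ) : Set where
  rel : (R : Rel σ) → Vec (Term σ nv) (rarity σ R) → Atom σ nv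
  eq  : Term σ nv → Term σ nv → Atom σ nv

data Formula (σ : Signature) (nv : ℕ) : Set where
  pos   : Atom σ nv → Formula σ nv
  neg   : Atom σ nv → Formula σ nv
  dep   : ∀ {l p} → Vec (Fin nv) l → Vec (Fin nv) p → Formula σ nv
  inc   : ∀ {l} → Vec (Fin nv) l → Vec (Fin nv) l → Formula σ nv
  ind   : ∀ {l p q} → Vec (Fin nv) l → Vec (Fin nv) p → Vec (Fin nv) q
        → Formula σ nv                                   -- ind x⃗ y⃗ z⃗ : y⃗ ⊥_x⃗ z⃗
  _∧'_  : Formula σ nv → Formula σ nv → Formula σ nv
  _∨'_  : Formula σ nv → Formula σ nv → Formula σ nv
  ex    : Fin nv → Formula σ nv → Formula σ nv
  all   : Fin nv → Formula σ nv → Formula σ nv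

-- Multistructures: a finite nonempty domain Fin (suc k) carrying a
-- multiplicity function (every element occurs at least once).

record MultiStructure (σ : Signature) (k : ℕ) : Set₁ where
  field
    mult     : Fin (suc k) → ℕ
    mult-pos : ∀ a → 1 ≤ mult a
    relI     : (R : Rel σ) → Vec (Fin (suc k)) (rarity σ R) → Set
    funI     : (f : Fun σ) → Vec (Fin (suc k)) (farity σ f) → Fin (suc k)
open MultiStructure public

Asg : ℕ → ℕ → Set
Asg nv k = Vec (Fin (suc k)) nv

-- A multiteam is a multiplicity function on assignments (the team X is
-- the finite set of all assignments; zero multiplicities allowed).
Multiteam : ℕ → ℕ → Set
Multiteam nv k = Asg nv k → ℕ

sumFin : ∀ {n} → (Fin n → ℕ) → ℕ
sumFin {zero}  f = 0
sumFin {suc n} f = f Fin.zero + sumFin (λ i → f (Fin.suc i))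

sgn : ℕ → ℕ
sgn zero    = 0
sgn (suc _) = 1

flatten : ∀ {nv k} → Multiteam nv k → Multiteam nv k
flatten m s = sgn (m s)

module _ {σ : Signature} {k : ℕ} (𝔄 : MultiStructure σ k) {nv : ℕ} where

  mutual
    ⟦_⟧t : Term σ nv → Asg nv k → Fin (suc k)
    ⟦ var x ⟧t s    = lookup s x
    ⟦ app f ts ⟧t s = funI 𝔄 f (⟦ ts ⟧ts s)

    ⟦_⟧ts : ∀ {n} → Vec (Term σ nv) n → Asg nv k → Vec (Fin (suc k)) n
    ⟦ [] ⟧ts s     = []
    ⟦ t ∷ ts ⟧ts s = ⟦ t ⟧t s ∷ ⟦ ts ⟧ts s

  _⊨a_ : Asg nv k → Atom σ nv → Set
  s ⊨a rel R ts = relI 𝔄 R (⟦ ts ⟧ts s)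
  s ⊨a eq t u   = ⟦ t ⟧t s ≡ ⟦ u ⟧t s

  _∈⁺_ : Asg nv k → Multiteam nv k → Set
  s ∈⁺ m = 1 ≤ m s

  _⊨[_] : Multiteam nv k → Formula σ nv → Set
  m ⊨[ pos α ] = ∀ s → s ∈⁺ m → s ⊨a α
  m ⊨[ neg α ] = ∀ s → s ∈⁺ m → ¬ (s ⊨a α)
  m ⊨[ dep xs ys ] = ∀ s s' → s ∈⁺ m → s' ∈⁺ m →
                     map (lookup s) xs ≡ map (lookup s') xs →
                     map (lookup s) ys ≡ map (lookup s') ys
  m ⊨[ inc xs ys ] = ∀ s → s ∈⁺ m →
                     ∃ λ s' → s' ∈⁺ m × map (lookup s) xs ≡ map (lookup s') ys
  m ⊨[ ind xs ys zs ] = ∀ s s' → s ∈⁺ m → s' ∈⁺ m →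
                     map (lookup s) xs ≡ map (lookup s') xs →
                     ∃ λ s'' → s'' ∈⁺ m
                       × map (lookup s'') xs ≡ map (lookup s) xs
                       × map (lookup s'') ys ≡ map (lookup s) ys
                       × map (lookup s'') zs ≡ map (lookup s') zs
  m ⊨[ φ ∧' ψ ] = (m ⊨[ φ ]) × (m ⊨[ ψ ])
  -- lax disjunction: every copy of an assignment goes to at least one side
  m ⊨[ φ ∨' ψ ] = Σ (Multiteam nv k) λ n → Σ (Multiteam nv k) λ n' →
                     (∀ s → n s ≤ m s) × (∀ s → n' s ≤ m s)
                     × (∀ s → m s ≤ n s + n' s)
                     × (n ⊨[ φ ]) × (n' ⊨[ ψ ])
  -- lax existential: each of the m(s) copies of s picks a nonempty set of
  -- values for x; F s a is the number of copies of s that pick a.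
  m ⊨[ ex x φ ] = Σ (Asg nv k → Fin (suc k) → ℕ) λ F →
                     (∀ s a → F s a ≤ m s) × (∀ s → m s ≤ sumFin (F s))
                     × ((λ t → sumFin (λ b → F (t [ x ]≔ b) (lookup t x))) ⊨[ φ ])
  -- universal: (X,m)[A/x], each copy of s(a/x) weighted by mult(a)
  m ⊨[ all x φ ] = (λ t → mult 𝔄 (lookup t x) * sumFin (λ b → m (t [ x ]≔ b))) ⊨[ φ ]

WeaklyFlat : ∀ {σ nv} → Formula σ nv → Set₁
WeaklyFlat {σ} {nv} φ = ∀ {k} (𝔄 : MultiStructure σ k) (m : Multiteam nv k) →
  (_⊨[_] 𝔄 m φ) ⇔ (_⊨[_] 𝔄 (flatten m) φ)

module Submission where

-- Idea: every atom only looks at the support {s | m(s) ≥ 1} of a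
-- multiteam, and every connective and quantifier transforms multiplicities
-- in a way that respects supports.  So we prove the stronger
--
--   support invariance:  if m and m' have the same support, then
--                        m ⊨ φ  implies  m' ⊨ φ,
--
-- For ∨ and ∃ the witnessing split (resp. choice
-- function) for m is transported to m' by "guarding": every multiplicity
-- of m' is kept exactly where the old witness was nonzero.

open import Defs
open import Data.Nat using (ℕ; zero; suc; _+_; _*_; _≤_; z≤n; s≤s)
open import Data.Nat.Properties using (≤-refl; ≤-trans; m≤m+n; m≤n+m; *-zeroʳ)
open import Data.Fin using (Fin)
open import Data.Product using (∃; _×_; _,_; proj₁; proj₂; swap)
open import Data.Sum using (_⊎_; inj₁; inj₂)
open import Data.Vec using (lookup; _[_]≔_)
open import Function.Bundles using (mk⇔)

infix 4 _≈⁺_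
_≈⁺_ : ℕ → ℕ → Set
a ≈⁺ b = (1 ≤ a → 1 ≤ b) × (1 ≤ b → 1 ≤ a)

≈⁺-sym : ∀ {a b} → a ≈⁺ b → b ≈⁺ a
≈⁺-sym = swap

≈⁺-trans : ∀ {a b c} → a ≈⁺ b → b ≈⁺ c → a ≈⁺ c
≈⁺-trans (ab , ba) (bc , cb) = (λ p → bc (ab p)) , (λ p → ba (cb p))

sgn-≈⁺ : ∀ a → sgn a ≈⁺ a
sgn-≈⁺ zero    = (λ ()) , (λ ())
sgn-≈⁺ (suc a) = (λ _ → s≤s z≤n) , (λ _ → s≤s z≤n)

scale-≈⁺ : ∀ c b → 1 ≤ c → c * b ≈⁺ b
scale-≈⁺ c zero    _ rewrite *-zeroʳ c = (λ ()) , (λ ())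
scale-≈⁺ (suc c) (suc b) _ = (λ _ → s≤s z≤n) , (λ _ → s≤s z≤n)

*-congˡ-≈⁺ : ∀ c {b b'} → 1 ≤ c → b ≈⁺ b' → c * b ≈⁺ c * b'
*-congˡ-≈⁺ c {b} {b'} c≥1 b≈b' =
  ≈⁺-trans (scale-≈⁺ c b c≥1) (≈⁺-trans b≈b' (≈⁺-sym (scale-≈⁺ c b' c≥1)))

+-pos : ∀ a b → 1 ≤ a + b → 1 ≤ a ⊎ 1 ≤ b
+-pos zero    b p = inj₂ p
+-pos (suc a) b _ = inj₁ (s≤s z≤n)

≤-sumFin : ∀ {n} (f : Fin n → ℕ) i → f i ≤ sumFin f
≤-sumFin f Fin.zero    = m≤m+n _ _
≤-sumFin f (Fin.suc i) = ≤-trans (≤-sumFin (λ j → f (Fin.suc j)) i) (m≤n+m _ _)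

sumFin-pos : ∀ {n} (f : Fin n → ℕ) → 1 ≤ sumFin f → ∃ λ i → 1 ≤ f i
sumFin-pos {zero}  f ()
sumFin-pos {suc n} f p with +-pos (f Fin.zero) _ p
... | inj₁ q = Fin.zero , q
... | inj₂ q with sumFin-pos (λ j → f (Fin.suc j)) q
...   | i , r = Fin.suc i , r

sumFin-cong-≈⁺ : ∀ {n} (f g : Fin n → ℕ) → (∀ i → f i ≈⁺ g i) → sumFin f ≈⁺ sumFin g
sumFin-cong-≈⁺ {n} f g f≈g = transfer f g (λ i → proj₁ (f≈g i))
                           , transfer g f (λ i → proj₂ (f≈g i))
  where
  transfer : (u v : Fin n → ℕ) → (∀ i → 1 ≤ u i → 1 ≤ v i) → 1 ≤ sumFin u → 1 ≤ sumFin v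
  transfer u v u⇒v p with sumFin-pos u p
  ... | i , q = ≤-trans (u⇒v i q) (≤-sumFin v i)

-- guard a y keeps the y copies exactly where a is nonzero.  It transports
-- a witness (a split or a choice function) for one multiteam to another
-- multiteam with the same support.
guard : ℕ → ℕ → ℕ
guard zero    y = 0
guard (suc _) y = y

guard-≤ : ∀ a y → guard a y ≤ y
guard-≤ zero    y = z≤n
guard-≤ (suc a) y = ≤-refl

guard-pos : ∀ a y → 1 ≤ a → y ≤ guard a y
guard-pos (suc a) y _ = ≤-refl

guard-≈⁺ : ∀ a y → (1 ≤ a → 1 ≤ y) → guard a y ≈⁺ a
guard-≈⁺ zero    y _   = (λ ()) , (λ ())
guard-≈⁺ (suc a) y a⇒y = (λ _ → s≤s z≤n) , (λ _ → a⇒y (s≤s z≤n))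

guard-cover : ∀ a b y → (1 ≤ y → 1 ≤ a + b) → y ≤ guard a y + guard b y
guard-cover a b zero    _     = z≤n
guard-cover a b (suc y) cover with +-pos a b (cover (s≤s z≤n))
... | inj₁ a≥1 = ≤-trans (guard-pos a (suc y) a≥1) (m≤m+n _ _)
... | inj₂ b≥1 = ≤-trans (guard-pos b (suc y) b≥1) (m≤n+m _ _)

guard-cover-sumFin : ∀ {n} (f : Fin n → ℕ) y → (1 ≤ y → 1 ≤ sumFin f) →
                     y ≤ sumFin (λ i → guard (f i) y)
guard-cover-sumFin f zero    _     = z≤n
guard-cover-sumFin f (suc y) cover with sumFin-pos f (cover (s≤s z≤n))
... | i , fi≥1 = ≤-trans (guard-pos (f i) (suc y) fi≥1) (≤-sumFin (λ j → guard (f j) (suc y)) i)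

SameSupport : ∀ {nv k} → Multiteam nv k → Multiteam nv k → Set
SameSupport m m' = ∀ s → m s ≈⁺ m' s

module _ {σ : Signature} {k : ℕ} (𝔄 : MultiStructure σ k) {nv : ℕ} where

  support-invariance : (φ : Formula σ nv) {m m' : Multiteam nv k} →
                       SameSupport m m' → _⊨[_] 𝔄 m φ → _⊨[_] 𝔄 m' φ
  support-invariance (pos α) m≈m' h s p = h s (proj₂ (m≈m' s) p)
  support-invariance (neg α) m≈m' h s p = h s (proj₂ (m≈m' s) p)
  support-invariance (dep xs ys) m≈m' h s s' p p' =
    h s s' (proj₂ (m≈m' s) p) (proj₂ (m≈m' s') p')
  support-invariance (inc xs ys) m≈m' h s p with h s (proj₂ (m≈m' s) p)
  ... | s' , q , e = s' , proj₁ (m≈m' s') q , e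
  support-invariance (ind xs ys zs) m≈m' h s s' p p' e
    with h s s' (proj₂ (m≈m' s) p) (proj₂ (m≈m' s') p') e
  ... | s'' , q , rest = s'' , proj₁ (m≈m' s'') q , rest
  support-invariance (φ ∧' ψ) m≈m' (hφ , hψ) =
    support-invariance φ m≈m' hφ , support-invariance ψ m≈m' hψ
  support-invariance (φ ∨' ψ) {m} {m'} m≈m' (n , n' , n≤m , n'≤m , cover , hφ , hψ) =
    guarded n , guarded n'
    , (λ s → guard-≤ (n s) (m' s)) , (λ s → guard-≤ (n' s) (m' s))
    , (λ s → guard-cover (n s) (n' s) (m' s)
               (λ p → ≤-trans (proj₂ (m≈m' s) p) (cover s)))
    , support-invariance φ (λ s → ≈⁺-sym (guarded-≈⁺ n n≤m s)) hφ
    , support-invariance ψ (λ s → ≈⁺-sym (guarded-≈⁺ n' n'≤m s)) hψ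
    where
    guarded : Multiteam nv k → Multiteam nv k
    guarded n s = guard (n s) (m' s)
    guarded-≈⁺ : (n : Multiteam nv k) → (∀ s → n s ≤ m s) → ∀ s → guarded n s ≈⁺ n s
    guarded-≈⁺ n n≤m s =
      guard-≈⁺ (n s) (m' s) (λ p → proj₁ (m≈m' s) (≤-trans p (n≤m s)))
  support-invariance (ex x φ) {m} {m'} m≈m' (F , F≤m , cover , hφ) =
    F' , (λ s a → guard-≤ (F s a) (m' s))
    , (λ s → guard-cover-sumFin (F s) (m' s)
               (λ p → ≤-trans (proj₂ (m≈m' s) p) (cover s)))
    , support-invariance φ
        (λ t → sumFin-cong-≈⁺ _ _ (λ b → ≈⁺-sym (F'-≈⁺ (t [ x ]≔ b) (lookup t x))))
        hφ
    where
    F' : Asg nv k → Fin (suc k) → ℕ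
    F' s a = guard (F s a) (m' s)
    F'-≈⁺ : ∀ s a → F' s a ≈⁺ F s a
    F'-≈⁺ s a = guard-≈⁺ (F s a) (m' s) (λ p → proj₁ (m≈m' s) (≤-trans p (F≤m s a)))
  support-invariance (all x φ) {m} {m'} m≈m' h =
    support-invariance φ
      (λ t → *-congˡ-≈⁺ (mult 𝔄 (lookup t x)) (mult-pos 𝔄 (lookup t x))
               (sumFin-cong-≈⁺ _ _ (λ b → m≈m' (t [ x ]≔ b))))
      h

proposition6 : ∀ {σ : Signature} {nv} (φ : Formula σ nv) → WeaklyFlat φ
proposition6 φ 𝔄 m = mk⇔ (support-invariance 𝔄 φ m≈flat)
                          (support-invariance 𝔄 φ (λ s → ≈⁺-sym (m≈flat s)))
  where
  m≈flat : SameSupport m (flatten m)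
  m≈flat s = ≈⁺-sym (sgn-≈⁺ (m s))
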